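{- Let $p$ be a prime, let $N>1$ be an integer prime to $p$, and let $\chi$ be a Dirichlet character of conductor $N$. Let $L_\chi(t)=\sum_{1\le a<N}\chi(a)\frac{t^a}{t^N-1}$. Then for every integer $n\ge 0$ and every integer $m$, the following identity holds in $\bar{\mathbf{Q}}$ (hence in $\mathbf{C}_p$): $$\sum_{\substack{\zeta\ne 1\\ \zeta^{p^n}=1}}L_\chi(\zeta)\zeta^{ -m} = \sum_{1\le a< N}\chi(a)\left(\frac{m-a}{N}\right)^\flat_{p^n},$$ where the sum on the left is over the nontrivial $p^n$-th roots of unity $\zeta$.
   Context: Fix embeddings of $\bar{\mathbf{Q}}$ into $\mathbf{C}$ and $\mathbf{C}_p$. For an integer $h>1$ and $b\in\mathbf{Z}/h$, $b^\flat_h$ denotes the unique integer in $[0,h)$ congruent to $b$ mod $h$; here $\frac{m-a}{N}$ is regarded as an element of $\mathbf{Z}/p^n$ (which makes sense since $N$ is invertible mod $p$). Note $L_\chi(\zeta)$ is defined for a nontrivial $p$-power root of unity $\zeta$ since $\zeta^N\neq 1$. -}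

module Defs where

open import Level using (Level; _⊔_) renaming (suc to lsuc)
open import Data.Nat as ℕ using (ℕ; zero; suc; _<_; _≤_)
open import Data.Nat.Divisibility as ℕD using (_∣?_)
open import Data.Nat.Coprimality using (Coprime)
open import Data.Integer as ℤ using (ℤ; +_; -[1+_])
open import Data.Integer.Divisibility as ℤD using ()
open import Data.List using (List; []; _∷_; upTo; filter)
open import Relation.Nullary using (¬_)
open import Data.Product using () renaming (_×_ to _∧_)
open import Algebra.Bundles using (CommutativeRing; Semiring)
import Algebra.Definitions.RawSemiring as RS

-- Fields: a commutative ring with 0 ≠ 1 and a (total) inverse map that is
-- a multiplicative inverse on nonzero elements (value at 0 irrelevant).

record Field (c ℓ : Level) : Set (lsuc (c ⊔ ℓ)) where
  field
    commutativeRing : CommutativeRing c ℓ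
  open CommutativeRing commutativeRing public
  field
    _⁻¹      : Carrier → Carrier
    0≉1      : ¬ (0# ≈ 1#)
    ⁻¹-inverseʳ : ∀ x → ¬ (x ≈ 0#) → (x * (x ⁻¹)) ≈ 1#
  open RS (Semiring.rawSemiring semiring) public using (_×_; _^_)

module FieldDefs {c ℓ : Level} (K : Field c ℓ) where
  open Field K

  CharZero : Set ℓ
  CharZero = ∀ (n : ℕ) → ¬ ((suc n × 1#) ≈ 0#)

  _^ℤ_ : Carrier → ℤ → Carrier
  x ^ℤ (+ n)    = x ^ n
  x ^ℤ -[1+ n ] = (x ⁻¹) ^ (suc n)

  IsPrimitiveRoot : ℕ → Carrier → Set ℓ
  IsPrimitiveRoot h ω = ((ω ^ h) ≈ 1#) ∧ (∀ k → 0 < k → k < h → ¬ ((ω ^ k) ≈ 1#))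

  sumFrom : ℕ → ℕ → (ℕ → Carrier) → Carrier
  sumFrom lo zero      f = 0#
  sumFrom lo (suc len) f = f lo + sumFrom (suc lo) len f

  sum1≤_<_ : ℕ → (ℕ → Carrier) → Carrier
  sum1≤_<_ h f = sumFrom 1 (h ℕ.∸ 1) f

  record IsDirichletChar (N : ℕ) (χ : ℕ → Carrier) : Set ℓ where
    field
      periodic : ∀ a → χ (a ℕ.+ N) ≈ χ a
      mult     : ∀ a b → χ (a ℕ.* b) ≈ (χ a * χ b)
      one      : χ 1 ≈ 1#
      zero-iff-nonCoprime₁ : ∀ a → χ a ≈ 0# → ¬ Coprime a N
      zero-iff-nonCoprime₂ : ∀ a → ¬ Coprime a N → χ a ≈ 0#

  InducedFrom : ℕ → ℕ → (ℕ → Carrier) → Set ℓ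
  InducedFrom N d χ = ∀ a b → Coprime a N → Coprime b N →
    (+ d) ℤD.∣ ((+ a) ℤ.- (+ b)) → χ a ≈ χ b

  record HasConductor (N : ℕ) (χ : ℕ → Carrier) : Set ℓ where
    field
      isChar    : IsDirichletChar N χ
      isPrimitive : ∀ d → d ℕD.∣ N → d < N → ¬ InducedFrom N d χ

  Lχ : ℕ → (ℕ → Carrier) → Carrier → Carrier
  Lχ N χ t = sum1≤ N < (λ a → (χ a * (t ^ a)) * (((t ^ N) - 1#) ⁻¹))

-- ((b / N))^♭_h : the unique r ∈ [0,h) with N·r ≡ b (mod h)
-- (computed as the least such r; default 0 if none exists, which never
-- happens when gcd(N,h) = 1).

flatDiv : (h N : ℕ) → ℤ → ℕ
flatDiv h N b with filter (λ r → h ∣? ℤ.∣ ((+ N) ℤ.* (+ r)) ℤ.- b ∣) (upTo h)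
... | []    = 0
... | r ∷ _ = r

{-# OPTIONS --safe #-}
module Submission where

-- Write ζ = ω^k, u = ζ^N and r_a = ((m - a)/N)♭. Since N(h - r_a) ≡ a - m (mod h),
-- L_χ(ζ) ζ^(-m) = Σ_a χ(a) u^(h - r_a) / (u - 1). Now u^s / (u - 1) = 1 / (u - 1) - Σ_{s ≤ i < h} u^i,
-- and for 0 < i < h the sum over k of u^i = (ω^(Ni))^k is -1, as ω^(Ni) ≠ 1 for N prime to h.
-- So the left side is Σ_a χ(a) (C + r_a) with C = Σ_k 1 / (u - 1) independent of a, and
-- Σ_a χ(a) = 0 as χ is not principal.

open import Defs
open import Level using (Level)
open import Data.Nat as ℕ using (ℕ; zero; suc; _<_; _≤_; _∸_; z≤n; s≤s; NonZero)
import Data.Nat.Properties as ℕP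
open import Data.Nat.DivMod using (_%_; _/_; m%n<n; m≡m%n+[m/n]*n)
import Data.Nat.Divisibility as ℕD
open import Data.Nat.Primality using (Prime; prime⇒nonZero)
open import Data.Nat.Coprimality as Coprimality using (Coprime; coprime?; coprime-Bézout)
open import Data.Nat.GCD using (module Bézout)
open import Data.Integer as ℤ using (ℤ; +_; -[1+_])
import Data.Integer.Properties as ℤP
open import Data.Integer.DivMod using (_%ℕ_; _/ℕ_; a≡a%ℕn+[a/ℕn]*n; n%ℕd<d)
import Data.Integer.Divisibility.Signed as ℤD
open import Data.Integer.Tactic.RingSolver using (solve-∀)
open import Data.Fin using (Fin; toℕ; fromℕ<)
import Data.Fin.Properties as FinP
open import Data.Fin.Permutation using (Permutation; permutation; _⟨$⟩ʳ_)
open import Data.List using ([]; _∷_; upTo; filter)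
open import Data.List.Membership.Propositional using (_∈_)
open import Data.List.Membership.Propositional.Properties using (∈-filter⁺; ∈-filter⁻; ∈-upTo⁺; ∈-upTo⁻)
open import Data.List.Relation.Unary.Any using (here)
open import Data.Product using (Σ-syntax; ∃-syntax; _,_; proj₁; proj₂) renaming (_×_ to _∧_)
open import Relation.Binary.Bundles using (Setoid)
import Relation.Binary.PropositionalEquality as ≡
open ≡ using (_≡_)
import Relation.Binary.Reasoning.Setoid as SetoidReasoning
open import Relation.Nullary using (¬_; yes; no; contradiction)
open import Relation.Unary using (Decidable)
import Algebra.Properties.CommutativeSemigroup as CommutativeSemigroupProperties
import Algebra.Properties.AbelianGroup as AbelianGroupProperties
import Algebra.Properties.Group as GroupProperties
import Algebra.Properties.Ring as RingProperties
import Algebra.Properties.Semiring.Exp as ExpProperties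
import Algebra.Properties.Semiring.Mult as MultProperties
import Algebra.Properties.Monoid.Mult as MonoidMultProperties
import Algebra.Properties.CommutativeMonoid.Sum as SumProperties

-- Congruences of integers

-- A record rather than a synonym, so that x and y are recovered by unification.
infix 4 _≡_mod_
record _≡_mod_ (x y : ℤ) (h : ℕ) : Set where
  constructor ≡-mod
  field divides-difference : + h ℤD.∣ x ℤ.- y
open _≡_mod_ public

module _ {h : ℕ} where

  ≡-mod-reflexive : ∀ {x y} → x ≡ y → x ≡ y mod h
  ≡-mod-reflexive {x} ≡.refl = ≡-mod (ℤD.divides (+ 0) (ℤP.+-inverseʳ x))

  ≡-mod-refl : ∀ x → x ≡ x mod h
  ≡-mod-refl x = ≡-mod-reflexive ≡.refl

  ≡-mod-sym : ∀ {x y} → x ≡ y mod h → y ≡ x mod h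
  ≡-mod-sym {x} {y} (≡-mod h∣x-y) = ≡-mod (≡.subst (+ h ℤD.∣_) (negate x y) (ℤD.∣m⇒∣-m h∣x-y))
    where
    negate : ∀ x y → ℤ.- (x ℤ.- y) ≡ y ℤ.- x
    negate = solve-∀

  ≡-mod-trans : ∀ {x y z} → x ≡ y mod h → y ≡ z mod h → x ≡ z mod h
  ≡-mod-trans {x} {y} {z} (≡-mod h∣x-y) (≡-mod h∣y-z) =
    ≡-mod (≡.subst (+ h ℤD.∣_) (ℤP.+-minus-telescope x y z) (ℤD.∣m∣n⇒∣m+n h∣x-y h∣y-z))

  ≡-mod-+ : ∀ {x x′ y y′} → x ≡ x′ mod h → y ≡ y′ mod h → x ℤ.+ y ≡ x′ ℤ.+ y′ mod h
  ≡-mod-+ {x} {x′} {y} {y′} (≡-mod h∣x-x′) (≡-mod h∣y-y′) =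
    ≡-mod (≡.subst (+ h ℤD.∣_) (regroup x x′ y y′) (ℤD.∣m∣n⇒∣m+n h∣x-x′ h∣y-y′))
    where
    regroup : ∀ x x′ y y′ → (x ℤ.- x′) ℤ.+ (y ℤ.- y′) ≡ (x ℤ.+ y) ℤ.- (x′ ℤ.+ y′)
    regroup = solve-∀

  ≡-mod-* : ∀ {x x′ y y′} → x ≡ x′ mod h → y ≡ y′ mod h → x ℤ.* y ≡ x′ ℤ.* y′ mod h
  ≡-mod-* {x} {x′} {y} {y′} (≡-mod h∣x-x′) (≡-mod h∣y-y′) =
    ≡-mod (≡.subst (+ h ℤD.∣_) (regroup x x′ y y′)
      (ℤD.∣m∣n⇒∣m+n (ℤD.∣n⇒∣m*n x h∣y-y′) (ℤD.∣m⇒∣m*n y′ h∣x-x′)))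
    where
    regroup : ∀ x x′ y y′ → x ℤ.* (y ℤ.- y′) ℤ.+ (x ℤ.- x′) ℤ.* y′ ≡ x ℤ.* y ℤ.- x′ ℤ.* y′
    regroup = solve-∀

  ≡-mod-neg : ∀ {x y} → x ≡ y mod h → ℤ.- x ≡ ℤ.- y mod h
  ≡-mod-neg {x} {y} (≡-mod h∣x-y) = ≡-mod (≡.subst (+ h ℤD.∣_) (regroup x y) (ℤD.∣m⇒∣-m h∣x-y))
    where
    regroup : ∀ x y → ℤ.- (x ℤ.- y) ≡ ℤ.- x ℤ.- ℤ.- y
    regroup = solve-∀

  +-multiple≡-mod : ∀ x k → x ℤ.+ k ℤ.* + h ≡ x mod h
  +-multiple≡-mod x k = ≡-mod (ℤD.divides k (cancel x (k ℤ.* + h)))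
    where
    cancel : ∀ x y → x ℤ.+ y ℤ.- x ≡ y
    cancel = solve-∀

  ≡-mod-setoid : Setoid _ _
  ≡-mod-setoid = record
    { Carrier       = ℤ
    ; _≈_           = λ x y → x ≡ y mod h
    ; isEquivalence = record { refl = ≡-mod-refl _ ; sym = ≡-mod-sym ; trans = ≡-mod-trans }
    }

%ℕ-≡-mod : ∀ z h .{{_ : NonZero h}} → + (z %ℕ h) ≡ z mod h
%ℕ-≡-mod z h = ≡.subst (λ w → + (z %ℕ h) ≡ w mod h) (≡.sym (a≡a%ℕn+[a/ℕn]*n z h))
  (≡-mod (ℤD.divides (ℤ.- (z /ℕ h)) (cancel (+ (z %ℕ h)) (z /ℕ h) (+ h))))
  where
  cancel : ∀ r q h → r ℤ.- (r ℤ.+ q ℤ.* h) ≡ ℤ.- q ℤ.* h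
  cancel = solve-∀

%-≡-mod : ∀ n h .{{_ : NonZero h}} → + (n % h) ≡ + n mod h
%-≡-mod n = %ℕ-≡-mod (+ n)

pred-*≡-mod : ∀ h .{{_ : NonZero h}} n → + (ℕ.pred h ℕ.* suc n) ≡ -[1+ n ] mod h
pred-*≡-mod h n = ≡-mod (ℤD.divides (+ suc n) (begin
  + (ℕ.pred h ℕ.* suc n ℕ.+ suc n) ≡⟨ ≡.cong +_ (ℕP.+-comm (ℕ.pred h ℕ.* suc n) (suc n)) ⟩
  + (suc (ℕ.pred h) ℕ.* suc n)     ≡⟨ ≡.cong (λ k → + (k ℕ.* suc n)) (ℕP.suc-pred h) ⟩
  + (h ℕ.* suc n)                  ≡⟨ ≡.cong +_ (ℕP.*-comm h (suc n)) ⟩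
  + (suc n ℕ.* h)                  ≡⟨ ℤP.pos-* (suc n) h ⟩
  + suc n ℤ.* + h                  ∎))
  where open ≡.≡-Reasoning

≡-mod-residue-unique : ∀ {h i j} → i < h → j < h → + i ≡ + j mod h → i ≡ j
≡-mod-residue-unique {h} {i} {j} i<h j<h i≡j with ℤ.∣ + i ℤ.- + j ∣ in eq
... | zero  = ℤP.+-injective (ℤP.i-j≡0⇒i≡j (+ i) (+ j) (ℤP.∣i∣≡0⇒i≡0 eq))
... | suc d = contradiction (≡.subst (h ℕD.∣_) eq (ℤD.∣⇒∣ᵤ (divides-difference i≡j)))
                (ℕD.>⇒∤ (ℕP.≤-<-trans ∣i-j∣≤i⊔j (ℕP.⊔-lub i<h j<h)))
  where
  ∣i-j∣≤i⊔j : suc d ≤ i ℕ.⊔ j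
  ∣i-j∣≤i⊔j = ≡.subst (_≤ i ℕ.⊔ j) eq
    (≡.subst (λ w → ℤ.∣ w ∣ ≤ i ℕ.⊔ j) (≡.sym (ℤP.[+m]-[+n]≡m⊖n i j)) (ℤP.∣m⊝n∣≤m⊔n i j))

coprime-^ : ∀ {m n} → Coprime m n → ∀ k → Coprime m (n ℕ.^ k)
coprime-^ m⊥n zero    (_ , d∣1) = ℕD.∣1⇒≡1 d∣1
coprime-^ m⊥n (suc k) {d} (d∣m , d∣n*n^k) = coprime-^ m⊥n k (d∣m , Coprimality.coprime-divisor d⊥n d∣n*n^k)
  where
  d⊥n : Coprime d _
  d⊥n (e∣d , e∣n) = m⊥n (ℕD.∣-trans e∣d d∣m , e∣n)

bézout⇒inverse-mod : ∀ {a h} → Coprime a h → Σ[ a′ ∈ ℤ ] a′ ℤ.* + a ≡ + 1 mod h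
bézout⇒inverse-mod {a} {h} a⊥h with coprime-Bézout a⊥h
... | Bézout.+- x y eq = + x , ≡-mod (ℤD.divides (+ y) (begin
  + x ℤ.* + a ℤ.- + 1             ≡⟨ ≡.cong (ℤ._- + 1) (ℤP.pos-* x a) ⟨
  + (x ℕ.* a) ℤ.- + 1             ≡⟨ ≡.cong (λ w → + w ℤ.- + 1) eq ⟨
  + 1 ℤ.+ + (y ℕ.* h) ℤ.- + 1     ≡⟨ cancel (+ (y ℕ.* h)) ⟩
  + (y ℕ.* h)                     ≡⟨ ℤP.pos-* y h ⟩
  + y ℤ.* + h                     ∎))
  where
  open ≡.≡-Reasoning
  cancel : ∀ t → + 1 ℤ.+ t ℤ.- + 1 ≡ t
  cancel = solve-∀
... | Bézout.-+ x y eq = ℤ.- + x , ≡-mod (ℤD.divides (ℤ.- + y) (begin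
  ℤ.- + x ℤ.* + a ℤ.- + 1         ≡⟨ negate (+ x) (+ a) ⟩
  ℤ.- (+ 1 ℤ.+ + x ℤ.* + a)       ≡⟨ ≡.cong (λ w → ℤ.- (+ 1 ℤ.+ w)) (ℤP.pos-* x a) ⟨
  ℤ.- + (1 ℕ.+ x ℕ.* a)           ≡⟨ ≡.cong (λ w → ℤ.- + w) eq ⟩
  ℤ.- + (y ℕ.* h)                 ≡⟨ ≡.cong ℤ.-_ (ℤP.pos-* y h) ⟩
  ℤ.- (+ y ℤ.* + h)               ≡⟨ ℤP.neg-distribˡ-* (+ y) (+ h) ⟩
  ℤ.- + y ℤ.* + h                 ∎))
  where
  open ≡.≡-Reasoning
  negate : ∀ x a → ℤ.- x ℤ.* a ℤ.- + 1 ≡ ℤ.- (+ 1 ℤ.+ x ℤ.* a)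
  negate = solve-∀

coprime⇒inverse-mod : ∀ {a h} .{{_ : NonZero h}} → Coprime a h → Σ[ a′ ∈ ℕ ] + a′ ℤ.* + a ≡ + 1 mod h
coprime⇒inverse-mod {a} {h} a⊥h = a′ %ℕ h , ≡-mod-trans (≡-mod-* (%ℕ-≡-mod a′ h) (≡-mod-refl (+ a))) a′a≡1
  where
  a′ = proj₁ (bézout⇒inverse-mod a⊥h)
  a′a≡1 = proj₂ (bézout⇒inverse-mod a⊥h)

*-%-inverse : ∀ {N} .{{_ : NonZero N}} c d → + c ℤ.* + d ≡ + 1 mod N →
  ∀ {i} → i < N → (c ℕ.* ((d ℕ.* i) % N)) % N ≡ i
*-%-inverse {N} c d cd≡1 {i} i<N = ≡-mod-residue-unique (m%n<n _ N) i<N (begin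
  + ((c ℕ.* ((d ℕ.* i) % N)) % N) ≈⟨ %-≡-mod _ N ⟩
  + (c ℕ.* ((d ℕ.* i) % N))       ≡⟨ ℤP.pos-* c _ ⟩
  + c ℤ.* + ((d ℕ.* i) % N)       ≈⟨ ≡-mod-* (≡-mod-refl (+ c)) (%-≡-mod (d ℕ.* i) N) ⟩
  + c ℤ.* + (d ℕ.* i)             ≡⟨ ≡.cong (+ c ℤ.*_) (ℤP.pos-* d i) ⟩
  + c ℤ.* (+ d ℤ.* + i)           ≡⟨ ℤP.*-assoc (+ c) (+ d) (+ i) ⟨
  + c ℤ.* + d ℤ.* + i             ≈⟨ ≡-mod-* cd≡1 (≡-mod-refl (+ i)) ⟩
  + 1 ℤ.* + i                     ≡⟨ ℤP.*-identityˡ (+ i) ⟩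
  + i                             ∎)
  where open SetoidReasoning ≡-mod-setoid

*-%-permutation : ∀ {N b} .{{_ : NonZero N}} → Coprime b N → Permutation N N
*-%-permutation {N} {b} b⊥N = permutation (times b) (times b′) (inverse b b′ bb′≡1) (inverse b′ b b′b≡1)
  where
  b′ : ℕ
  b′ = proj₁ (coprime⇒inverse-mod b⊥N)
  b′b≡1 : + b′ ℤ.* + b ≡ + 1 mod N
  b′b≡1 = proj₂ (coprime⇒inverse-mod b⊥N)
  times : ℕ → Fin N → Fin N
  times k i = fromℕ< (m%n<n (k ℕ.* toℕ i) N)
  bb′≡1 : + b ℤ.* + b′ ≡ + 1 mod N
  bb′≡1 = ≡-mod-trans (≡-mod-reflexive (ℤP.*-comm (+ b) (+ b′))) b′b≡1
  inverse : ∀ c d → + c ℤ.* + d ≡ + 1 mod N → ∀ i → times c (times d i) ≡ i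
  inverse c d cd≡1 i = FinP.toℕ-injective (begin
    toℕ (times c (times d i))            ≡⟨ FinP.toℕ-fromℕ< (m%n<n (c ℕ.* toℕ (times d i)) N) ⟩
    (c ℕ.* toℕ (times d i)) % N          ≡⟨ ≡.cong (λ j → (c ℕ.* j) % N) (FinP.toℕ-fromℕ< (m%n<n (d ℕ.* toℕ i) N)) ⟩
    (c ℕ.* ((d ℕ.* toℕ i) % N)) % N      ≡⟨ *-%-inverse c d cd≡1 (FinP.toℕ<n i) ⟩
    toℕ i                                ∎)
    where open ≡.≡-Reasoning

-- The flat division ((b / N))♭_h

SolvesMod : ℕ → ℕ → ℤ → ℕ → Set
SolvesMod h N b r = h ℕD.∣ ℤ.∣ + N ℤ.* + r ℤ.- b ∣

solvesMod? : ∀ h N b → Decidable (SolvesMod h N b)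
solvesMod? h N b r = h ℕD.∣? ℤ.∣ + N ℤ.* + r ℤ.- b ∣

solvesMod⇒flatDiv-solvesMod : ∀ h N b {r} → r < h → SolvesMod h N b r →
  flatDiv h N b < h ∧ SolvesMod h N b (flatDiv h N b)
solvesMod⇒flatDiv-solvesMod h N b {r} r<h sol with filter (solvesMod? h N b) (upTo h) in eq
... | [] with () ← ≡.subst (r ∈_) eq (∈-filter⁺ (solvesMod? h N b) (∈-upTo⁺ r<h) sol)
... | r′ ∷ _ with r′∈ , r′-sol ← ∈-filter⁻ (solvesMod? h N b) (≡.subst (r′ ∈_) (≡.sym eq) (here ≡.refl)) =
  ∈-upTo⁻ r′∈ , r′-sol

inverse-solves-mod : ∀ {h} .{{_ : NonZero h}} N N′ → + N′ ℤ.* + N ≡ + 1 mod h →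
  ∀ b → + N ℤ.* + ((+ N′ ℤ.* b) %ℕ h) ≡ b mod h
inverse-solves-mod {h} N N′ N′N≡1 b = begin
  + N ℤ.* + ((+ N′ ℤ.* b) %ℕ h) ≈⟨ ≡-mod-* (≡-mod-refl (+ N)) (%ℕ-≡-mod (+ N′ ℤ.* b) h) ⟩
  + N ℤ.* (+ N′ ℤ.* b)          ≡⟨ ≡.trans (≡.cong (ℤ._* b) (ℤP.*-comm (+ N′) (+ N))) (ℤP.*-assoc (+ N) (+ N′) b) ⟨
  + N′ ℤ.* + N ℤ.* b            ≈⟨ ≡-mod-* N′N≡1 (≡-mod-refl b) ⟩
  + 1 ℤ.* b                     ≡⟨ ℤP.*-identityˡ b ⟩
  b                             ∎
  where open SetoidReasoning ≡-mod-setoid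

flatDiv-spec : ∀ {h N} .{{_ : NonZero h}} → Coprime N h → ∀ b →
  flatDiv h N b < h ∧ + N ℤ.* + flatDiv h N b ≡ b mod h
flatDiv-spec {h} {N} N⊥h b = proj₁ least , ≡-mod (ℤD.∣ᵤ⇒∣ (proj₂ least))
  where
  inverse = coprime⇒inverse-mod N⊥h
  N′ = proj₁ inverse
  least = solvesMod⇒flatDiv-solvesMod h N b (n%ℕd<d (+ N′ ℤ.* b) h)
            (ℤD.∣⇒∣ᵤ (divides-difference (inverse-solves-mod N N′ (proj₂ inverse) b)))

flatDiv-exponent : ∀ {h N} .{{_ : NonZero h}} → Coprime N h → ∀ m a →
  + (a ℕ.+ (ℤ.- m) %ℕ h) ≡ + (N ℕ.* (h ∸ flatDiv h N (m ℤ.- + a))) mod h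
flatDiv-exponent {h} {N} N⊥h m a = begin
  + a ℤ.+ + ((ℤ.- m) %ℕ h)          ≈⟨ ≡-mod-+ (≡-mod-refl (+ a)) (%ℕ-≡-mod (ℤ.- m) h) ⟩
  + a ℤ.+ ℤ.- m                     ≡⟨ negate (+ a) m ⟩
  ℤ.- (m ℤ.- + a)                   ≈⟨ ≡-mod-neg (≡-mod-sym (proj₂ spec)) ⟩
  ℤ.- (+ N ℤ.* + r)                 ≈⟨ +-multiple≡-mod _ (+ N) ⟨
  ℤ.- (+ N ℤ.* + r) ℤ.+ + N ℤ.* + h ≡⟨ factor (+ N) (+ r) (+ h) ⟩
  + N ℤ.* (+ h ℤ.- + r)             ≡⟨ ≡.cong (+ N ℤ.*_) h-r≡h∸r ⟩
  + N ℤ.* + (h ∸ r)                 ≡⟨ ℤP.pos-* N (h ∸ r) ⟨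
  + (N ℕ.* (h ∸ r))                 ∎
  where
  open SetoidReasoning ≡-mod-setoid
  r = flatDiv h N (m ℤ.- + a)
  spec = flatDiv-spec N⊥h (m ℤ.- + a)
  h-r≡h∸r : + h ℤ.- + r ≡ + (h ∸ r)
  h-r≡h∸r = ≡.trans (ℤP.[+m]-[+n]≡m⊖n h r) (ℤP.⊖-≥ (ℕP.<⇒≤ (proj₁ spec)))
  negate : ∀ a m → a ℤ.+ ℤ.- m ≡ ℤ.- (m ℤ.- a)
  negate = solve-∀
  factor : ∀ n r h → ℤ.- (n ℤ.* r) ℤ.+ n ℤ.* h ≡ n ℤ.* (h ℤ.- r)
  factor = solve-∀

module _ {c ℓ : Level} (K : Field c ℓ) where

  open Field K
  open FieldDefs K
  open SetoidReasoning setoid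
  open GroupProperties +-group using (inverseʳ-unique; ⁻¹-involutive; \\-leftDividesʳ; //-rightDividesˡ)
    renaming (x∙y⁻¹≈ε⇒x≈y to x-y≈0⇒x≈y; x≈y⇒x∙y⁻¹≈ε to x≈y⇒x-y≈0)
  open RingProperties ring using (x[y-z]≈xy-xz; -1*x≈-x)
  open ExpProperties semiring using (^-congˡ; ^-congʳ; ^-homo-*; ^-assocʳ)
  open MultProperties semiring using (×-comm-*)
  open MonoidMultProperties +-monoid using (×-congʳ)
  open AbelianGroupProperties +-abelianGroup using (⁻¹-anti-homo‿-)
  open CommutativeSemigroupProperties +-commutativeSemigroup using (interchange)
  open CommutativeSemigroupProperties *-commutativeSemigroup using (xy∙z≈y∙xz; xy∙z≈xz∙y)
  module Σ = SumProperties +-commutativeMonoid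

  -- Field arithmetic and finite sums

  x*y≈0⇒y≉0⇒x≈0 : ∀ {x y} → x * y ≈ 0# → ¬ y ≈ 0# → x ≈ 0#
  x*y≈0⇒y≉0⇒x≈0 {x} {y} xy≈0 y≉0 = begin
    x              ≈⟨ *-identityʳ x ⟨
    x * 1#         ≈⟨ *-congˡ (⁻¹-inverseʳ y y≉0) ⟨
    x * (y * y ⁻¹) ≈⟨ *-assoc x y (y ⁻¹) ⟨
    x * y * y ⁻¹   ≈⟨ *-congʳ xy≈0 ⟩
    0# * y ⁻¹      ≈⟨ zeroˡ (y ⁻¹) ⟩
    0#             ∎

  x*y≈y⇒y≉0⇒x≈1 : ∀ {x y} → x * y ≈ y → ¬ y ≈ 0# → x ≈ 1#
  x*y≈y⇒y≉0⇒x≈1 {x} {y} xy≈y y≉0 = x-y≈0⇒x≈y x 1# (x*y≈0⇒y≉0⇒x≈0 [x-1]y≈0 y≉0)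
    where
    [x-1]y≈0 : (x - 1#) * y ≈ 0#
    [x-1]y≈0 = begin
      (x - 1#) * y      ≈⟨ distribʳ y x (- 1#) ⟩
      x * y + - 1# * y  ≈⟨ +-cong xy≈y (-1*x≈-x y) ⟩
      y - y             ≈⟨ -‿inverseʳ y ⟩
      0#                ∎

  x*x≈y*x⇒x≉y⇒x≈0 : ∀ {x y} → x * x ≈ y * x → ¬ x ≈ y → x ≈ 0#
  x*x≈y*x⇒x≉y⇒x≈0 {x} {y} xx≈yx x≉y = x*y≈0⇒y≉0⇒x≈0 x[x-y]≈0 (λ x-y≈0 → x≉y (x-y≈0⇒x≈y x y x-y≈0))
    where
    x[x-y]≈0 : x * (x - y) ≈ 0#
    x[x-y]≈0 = trans (x[y-z]≈xy-xz x x y) (x≈y⇒x-y≈0 (trans xx≈yx (*-comm y x)))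

  ⁻¹-unique : ∀ {x y} → x * y ≈ 1# → x ⁻¹ ≈ y
  ⁻¹-unique {x} {y} xy≈1 = begin
    x ⁻¹             ≈⟨ *-identityʳ (x ⁻¹) ⟨
    x ⁻¹ * 1#        ≈⟨ *-congˡ xy≈1 ⟨
    x ⁻¹ * (x * y)   ≈⟨ *-assoc (x ⁻¹) x y ⟨
    x ⁻¹ * x * y     ≈⟨ *-congʳ (trans (*-comm (x ⁻¹) x) (⁻¹-inverseʳ x x≉0)) ⟩
    1# * y           ≈⟨ *-identityˡ y ⟩
    y                ∎
    where
    x≉0 : ¬ x ≈ 0#
    x≉0 x≈0 = 0≉1 (trans (sym (zeroˡ y)) (trans (*-congʳ (sym x≈0)) xy≈1))

  1#^n≈1# : ∀ n → 1# ^ n ≈ 1#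
  1#^n≈1# zero    = refl
  1#^n≈1# (suc n) = trans (*-identityˡ (1# ^ n)) (1#^n≈1# n)

  ^-comm : ∀ x m n → (x ^ m) ^ n ≈ (x ^ n) ^ m
  ^-comm x m n = begin
    (x ^ m) ^ n   ≈⟨ ^-assocʳ x m n ⟩
    x ^ (m ℕ.* n) ≡⟨ ≡.cong (x ^_) (ℕP.*-comm m n) ⟩
    x ^ (n ℕ.* m) ≈⟨ ^-assocʳ x n m ⟨
    (x ^ n) ^ m   ∎

  sumFrom-congᵢ : ∀ {f g : ℕ → Carrier} lo len →
    (∀ i → lo ≤ i → i < lo ℕ.+ len → f i ≈ g i) → sumFrom lo len f ≈ sumFrom lo len g
  sumFrom-congᵢ lo zero      f≈g = refl
  sumFrom-congᵢ lo (suc len) f≈g = +-cong (f≈g lo ℕP.≤-refl (ℕP.m<m+n lo (s≤s z≤n)))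
    (sumFrom-congᵢ (suc lo) len λ i lo<i i<lo+len →
      f≈g i (ℕP.<⇒≤ lo<i) (≡.subst (i <_) (≡.sym (ℕP.+-suc lo len)) i<lo+len))

  sumFrom-cong : ∀ {f g : ℕ → Carrier} lo len → (∀ i → f i ≈ g i) → sumFrom lo len f ≈ sumFrom lo len g
  sumFrom-cong lo len f≈g = sumFrom-congᵢ lo len (λ i _ _ → f≈g i)

  sumFrom-zero : ∀ lo len → sumFrom lo len (λ _ → 0#) ≈ 0#
  sumFrom-zero lo zero      = refl
  sumFrom-zero lo (suc len) = trans (+-identityˡ _) (sumFrom-zero (suc lo) len)

  sumFrom-const : ∀ x lo len → sumFrom lo len (λ _ → x) ≈ len × x
  sumFrom-const x lo zero      = refl
  sumFrom-const x lo (suc len) = +-congˡ (sumFrom-const x (suc lo) len)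

  sumFrom-distrib-+ : ∀ (f g : ℕ → Carrier) lo len →
    sumFrom lo len (λ i → f i + g i) ≈ sumFrom lo len f + sumFrom lo len g
  sumFrom-distrib-+ f g lo zero      = sym (+-identityˡ 0#)
  sumFrom-distrib-+ f g lo (suc len) =
    trans (+-congˡ (sumFrom-distrib-+ f g (suc lo) len)) (interchange _ _ _ _)

  *-distribˡ-sumFrom : ∀ x (f : ℕ → Carrier) lo len → x * sumFrom lo len f ≈ sumFrom lo len (λ i → x * f i)
  *-distribˡ-sumFrom x f lo zero      = zeroʳ x
  *-distribˡ-sumFrom x f lo (suc len) = trans (distribˡ x _ _) (+-congˡ (*-distribˡ-sumFrom x f (suc lo) len))

  *-distribʳ-sumFrom : ∀ x (f : ℕ → Carrier) lo len → sumFrom lo len f * x ≈ sumFrom lo len (λ i → f i * x)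
  *-distribʳ-sumFrom x f lo zero      = zeroˡ x
  *-distribʳ-sumFrom x f lo (suc len) = trans (distribʳ x _ _) (+-congˡ (*-distribʳ-sumFrom x f (suc lo) len))

  -‿distrib-sumFrom : ∀ (f : ℕ → Carrier) lo len → - sumFrom lo len f ≈ sumFrom lo len (λ i → - f i)
  -‿distrib-sumFrom f lo len = begin
    - sumFrom lo len f                     ≈⟨ -1*x≈-x _ ⟨
    - 1# * sumFrom lo len f                ≈⟨ *-distribˡ-sumFrom (- 1#) f lo len ⟩
    sumFrom lo len (λ i → - 1# * f i)      ≈⟨ sumFrom-cong lo len (λ i → -1*x≈-x (f i)) ⟩
    sumFrom lo len (λ i → - f i)           ∎

  sumFrom-comm : ∀ (F : ℕ → ℕ → Carrier) lo len lo′ len′ →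
    sumFrom lo len (λ i → sumFrom lo′ len′ (F i)) ≈ sumFrom lo′ len′ (λ j → sumFrom lo len (λ i → F i j))
  sumFrom-comm F lo zero      lo′ len′ = sym (sumFrom-zero lo′ len′)
  sumFrom-comm F lo (suc len) lo′ len′ = trans (+-congˡ (sumFrom-comm F (suc lo) len lo′ len′))
    (sym (sumFrom-distrib-+ (F lo) (λ j → sumFrom (suc lo) len (λ i → F i j)) lo′ len′))

  sumFrom≈∑ : ∀ (f : ℕ → Carrier) lo len → sumFrom lo len f ≈ Σ.sum {len} (λ i → f (lo ℕ.+ toℕ i))
  sumFrom≈∑ f lo zero      = refl
  sumFrom≈∑ f lo (suc len) = +-cong (reflexive (≡.cong f (≡.sym (ℕP.+-identityʳ lo))))
    (trans (sumFrom≈∑ f (suc lo) len) (reflexive (Σ.sum-cong-≗ {len} λ i → ≡.cong f (≡.sym (ℕP.+-suc lo (toℕ i))))))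

  sumFrom-*-% : ∀ {N b} .{{_ : NonZero N}} → Coprime b N → (f : ℕ → Carrier) →
    sumFrom 0 N (λ a → f ((b ℕ.* a) % N)) ≈ sumFrom 0 N f
  sumFrom-*-% {N} {b} b⊥N f = begin
    sumFrom 0 N (λ a → f ((b ℕ.* a) % N))     ≈⟨ sumFrom≈∑ (λ a → f ((b ℕ.* a) % N)) 0 N ⟩
    Σ.sum {N} (λ i → f ((b ℕ.* toℕ i) % N))   ≡⟨ Σ.sum-cong-≗ {N} (λ i → ≡.cong f (toℕ-π i)) ⟨
    Σ.sum {N} (λ i → f (toℕ (π ⟨$⟩ʳ i)))      ≈⟨ Σ.∑-permute (λ i → f (toℕ i)) π ⟨
    Σ.sum {N} (λ i → f (toℕ i))               ≈⟨ sumFrom≈∑ f 0 N ⟨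
    sumFrom 0 N f                             ∎
    where
    π = *-%-permutation b⊥N
    toℕ-π : ∀ i → toℕ (π ⟨$⟩ʳ i) ≡ (b ℕ.* toℕ i) % N
    toℕ-π i = FinP.toℕ-fromℕ< (m%n<n (b ℕ.* toℕ i) N)

  sumFrom0≈f0+sum1≤ : ∀ h .{{_ : NonZero h}} (f : ℕ → Carrier) → sumFrom 0 h f ≈ f 0 + sum1≤ h < f
  sumFrom0≈f0+sum1≤ (suc h) f = refl

  sum1≤-congᵢ : ∀ h .{{_ : NonZero h}} {f g : ℕ → Carrier} →
    (∀ i → 0 < i → i < h → f i ≈ g i) → sum1≤ h < f ≈ sum1≤ h < g
  sum1≤-congᵢ (suc h) = sumFrom-congᵢ 1 h

  -- Geometric sums and roots of unity

  geometric-telescope : ∀ y lo len → (y - 1#) * sumFrom lo len (y ^_) ≈ y ^ (lo ℕ.+ len) - y ^ lo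
  geometric-telescope y lo zero = begin
    (y - 1#) * 0#            ≈⟨ zeroʳ (y - 1#) ⟩
    0#                       ≈⟨ x≈y⇒x-y≈0 (^-congʳ y (ℕP.+-identityʳ lo)) ⟨
    y ^ (lo ℕ.+ 0) - y ^ lo  ∎
  geometric-telescope y lo (suc len) = begin
    (y - 1#) * (y ^ lo + sumFrom (suc lo) len (y ^_))
      ≈⟨ distribˡ (y - 1#) _ _ ⟩
    (y - 1#) * y ^ lo + (y - 1#) * sumFrom (suc lo) len (y ^_)
      ≈⟨ +-cong first-step (geometric-telescope y (suc lo) len) ⟩
    (y ^ suc lo - y ^ lo) + (y ^ (suc lo ℕ.+ len) - y ^ suc lo)
      ≈⟨ +-comm _ _ ⟩
    (y ^ (suc lo ℕ.+ len) - y ^ suc lo) + (y ^ suc lo - y ^ lo)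
      ≈⟨ +-assoc _ _ _ ⟩
    y ^ (suc lo ℕ.+ len) + (- y ^ suc lo + (y ^ suc lo - y ^ lo))
      ≈⟨ +-congˡ (\\-leftDividesʳ (y ^ suc lo) (- y ^ lo)) ⟩
    y ^ (suc lo ℕ.+ len) - y ^ lo
      ≡⟨ ≡.cong (λ k → y ^ k - y ^ lo) (ℕP.+-suc lo len) ⟨
    y ^ (lo ℕ.+ suc len) - y ^ lo
      ∎
    where
    first-step : (y - 1#) * y ^ lo ≈ y ^ suc lo - y ^ lo
    first-step = trans (distribʳ (y ^ lo) y (- 1#)) (+-congˡ (-1*x≈-x (y ^ lo)))

  geometric-tail : ∀ {u d h s} → (u - 1#) * d ≈ 1# → u ^ h ≈ 1# → s ≤ h →
    u ^ s * d ≈ d - sumFrom s (h ∸ s) (u ^_)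
  geometric-tail {u} {d} {h} {s} [u-1]d≈1 u^h≈1 s≤h = begin
    u ^ s * d                    ≈⟨ *-comm (u ^ s) d ⟩
    d * u ^ s                    ≈⟨ d-[d-x]≈x d (d * u ^ s) ⟨
    d - (d - d * u ^ s)          ≈⟨ +-congˡ (-‿cong tail≈) ⟨
    d - tail                     ∎
    where
    tail = sumFrom s (h ∸ s) (u ^_)
    d-[d-x]≈x : ∀ d x → d - (d - x) ≈ x
    d-[d-x]≈x d x = trans (+-congˡ (⁻¹-anti-homo‿- d x)) (trans (+-comm d (x - d)) (//-rightDividesˡ d x))
    tail≈ : tail ≈ d - d * u ^ s
    tail≈ = begin
      tail                     ≈⟨ *-identityˡ tail ⟨
      1# * tail                ≈⟨ *-congʳ [u-1]d≈1 ⟨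
      (u - 1#) * d * tail      ≈⟨ xy∙z≈y∙xz (u - 1#) d tail ⟩
      d * ((u - 1#) * tail)    ≈⟨ *-congˡ (geometric-telescope u s (h ∸ s)) ⟩
      d * (u ^ (s ℕ.+ (h ∸ s)) - u ^ s) ≈⟨ *-congˡ (+-congʳ (trans (^-congʳ u (ℕP.m+[n∸m]≡n s≤h)) u^h≈1)) ⟩
      d * (1# - u ^ s)         ≈⟨ x[y-z]≈xy-xz d 1# (u ^ s) ⟩
      d * 1# - d * u ^ s       ≈⟨ +-congʳ (*-identityʳ d) ⟩
      d - d * u ^ s            ∎

  module _ {h : ℕ} .{{_ : NonZero h}} {y : Carrier} (y^h≈1 : y ^ h ≈ 1#) where

    ^-root : ∀ k → (y ^ k) ^ h ≈ 1#
    ^-root k = trans (^-comm y k h) (trans (^-congˡ k y^h≈1) (1#^n≈1# k))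

    ^≈^% : ∀ n → y ^ n ≈ y ^ (n % h)
    ^≈^% n = begin
      y ^ n                              ≡⟨ ≡.cong (y ^_) (m≡m%n+[m/n]*n n h) ⟩
      y ^ (n % h ℕ.+ n / h ℕ.* h)        ≈⟨ ^-homo-* y (n % h) (n / h ℕ.* h) ⟩
      y ^ (n % h) * y ^ (n / h ℕ.* h)    ≈⟨ *-congˡ (trans (^-assocʳ y h (n / h)) (^-congʳ y (ℕP.*-comm h (n / h)))) ⟨
      y ^ (n % h) * (y ^ h) ^ (n / h)    ≈⟨ *-congˡ (trans (^-congˡ (n / h) y^h≈1) (1#^n≈1# (n / h))) ⟩
      y ^ (n % h) * 1#                   ≈⟨ *-identityʳ (y ^ (n % h)) ⟩
      y ^ (n % h)                        ∎

    ^-cong-mod : ∀ {i j} → + i ≡ + j mod h → y ^ i ≈ y ^ j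
    ^-cong-mod {i} {j} i≡j = begin
      y ^ i       ≈⟨ ^≈^% i ⟩
      y ^ (i % h) ≡⟨ ≡.cong (y ^_) (≡-mod-residue-unique (m%n<n i h) (m%n<n j h) residues-congruent) ⟩
      y ^ (j % h) ≈⟨ ^≈^% j ⟨
      y ^ j       ∎
      where
      residues-congruent : + (i % h) ≡ + (j % h) mod h
      residues-congruent = ≡-mod-trans (%-≡-mod i h) (≡-mod-trans i≡j (≡-mod-sym (%-≡-mod j h)))

    ⁻¹≈^pred : y ⁻¹ ≈ y ^ ℕ.pred h
    ⁻¹≈^pred = ⁻¹-unique (trans (^-congʳ y (ℕP.suc-pred h)) y^h≈1)

    ^ℤ≈^%ℕ : ∀ z → y ^ℤ z ≈ y ^ (z %ℕ h)
    ^ℤ≈^%ℕ (+ n)    = ^≈^% n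
    ^ℤ≈^%ℕ -[1+ n ] = begin
      (y ⁻¹) ^ suc n             ≈⟨ ^-congˡ (suc n) ⁻¹≈^pred ⟩
      (y ^ ℕ.pred h) ^ suc n     ≈⟨ ^-assocʳ y (ℕ.pred h) (suc n) ⟩
      y ^ (ℕ.pred h ℕ.* suc n)   ≈⟨ ^-cong-mod (≡-mod-trans (pred-*≡-mod h n) (≡-mod-sym (%ℕ-≡-mod -[1+ n ] h))) ⟩
      y ^ (-[1+ n ] %ℕ h)        ∎

    ^-twist≈^flatDiv : ∀ {N} → Coprime N h → ∀ m a →
      y ^ a * y ^ℤ (ℤ.- m) ≈ (y ^ N) ^ (h ∸ flatDiv h N (m ℤ.- + a))
    ^-twist≈^flatDiv {N} N⊥h m a = begin
      y ^ a * y ^ℤ (ℤ.- m)           ≈⟨ *-congˡ (^ℤ≈^%ℕ (ℤ.- m)) ⟩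
      y ^ a * y ^ ((ℤ.- m) %ℕ h)     ≈⟨ ^-homo-* y a ((ℤ.- m) %ℕ h) ⟨
      y ^ (a ℕ.+ (ℤ.- m) %ℕ h)       ≈⟨ ^-cong-mod (flatDiv-exponent N⊥h m a) ⟩
      y ^ (N ℕ.* (h ∸ r))            ≈⟨ ^-assocʳ y N (h ∸ r) ⟨
      (y ^ N) ^ (h ∸ r)              ∎
      where
      r = flatDiv h N (m ℤ.- + a)

    Lχ-twisted≈sum : ∀ {N} → Coprime N h → ∀ χ m → Lχ N χ y * y ^ℤ (ℤ.- m) ≈
      sum1≤ N < (λ a → χ a * ((y ^ N) ^ (h ∸ flatDiv h N (m ℤ.- + a)) * (y ^ N - 1#) ⁻¹))
    Lχ-twisted≈sum {N} N⊥h χ m =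
      trans (*-distribʳ-sumFrom (y ^ℤ (ℤ.- m)) _ 1 (N ∸ 1)) (sumFrom-cong 1 (N ∸ 1) λ a → begin
      χ a * y ^ a * d * y ^ℤ (ℤ.- m)    ≈⟨ xy∙z≈xz∙y (χ a * y ^ a) d (y ^ℤ (ℤ.- m)) ⟩
      χ a * y ^ a * y ^ℤ (ℤ.- m) * d    ≈⟨ *-congʳ (*-assoc (χ a) (y ^ a) (y ^ℤ (ℤ.- m))) ⟩
      χ a * (y ^ a * y ^ℤ (ℤ.- m)) * d  ≈⟨ *-assoc (χ a) _ d ⟩
      χ a * (y ^ a * y ^ℤ (ℤ.- m) * d)  ≈⟨ *-congˡ (*-congʳ (^-twist≈^flatDiv N⊥h m a)) ⟩
      χ a * ((y ^ N) ^ (h ∸ flatDiv h N (m ℤ.- + a)) * d) ∎)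
      where
      d = (y ^ N - 1#) ⁻¹

  sum1≤-root≈-1 : ∀ h .{{_ : NonZero h}} {y} → y ^ h ≈ 1# → ¬ y ≈ 1# → sum1≤ h < (y ^_) ≈ - 1#
  sum1≤-root≈-1 h {y} y^h≈1 y≉1 = inverseʳ-unique 1# _ (begin
    1# + sum1≤ h < (y ^_)   ≈⟨ sumFrom0≈f0+sum1≤ h (y ^_) ⟨
    sumFrom 0 h (y ^_)      ≈⟨ x*y≈0⇒y≉0⇒x≈0 (trans (*-comm _ (y - 1#)) [y-1]S≈0) y-1≉0 ⟩
    0#                      ∎)
    where
    y-1≉0 : ¬ y - 1# ≈ 0#
    y-1≉0 y-1≈0 = y≉1 (x-y≈0⇒x≈y y 1# y-1≈0)
    [y-1]S≈0 : (y - 1#) * sumFrom 0 h (y ^_) ≈ 0#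
    [y-1]S≈0 = trans (geometric-telescope y 0 h) (x≈y⇒x-y≈0 y^h≈1)

  -- Dirichlet characters

  principal : ℕ → ℕ → Carrier
  principal N b with coprime? b N
  ... | yes _ = 1#
  ... | no _  = 0#

  sumFrom-principal≈n×1 : ∀ N lo len → ∃[ k ] sumFrom lo len (principal N) ≈ k × 1#
  sumFrom-principal≈n×1 N lo zero = 0 , refl
  sumFrom-principal≈n×1 N lo (suc len) with k , S≈k ← sumFrom-principal≈n×1 N (suc lo) len | coprime? lo N
  ... | yes _ = suc k , +-congˡ S≈k
  ... | no _  = k , trans (+-identityˡ _) S≈k

  sum-principal≉0 : CharZero → ∀ {N} → 1 < N → ¬ sum1≤ N < principal N ≈ 0#
  sum-principal≉0 char0 {suc (suc N)} (s≤s (s≤s z≤n))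
    with k , S≈k ← sumFrom-principal≈n×1 (suc (suc N)) 2 N | coprime? 1 (suc (suc N))
  ... | yes _   = λ S≈0 → char0 k (trans (sym (+-congˡ S≈k)) S≈0)
  ... | no 1⊥̸N = contradiction (λ {d} → Coprimality.1-coprimeTo _ {d}) 1⊥̸N

  module _ {N : ℕ} (1<N : 1 < N) {χ : ℕ → Carrier} (χ-character : IsDirichletChar N χ) where
    open IsDirichletChar χ-character

    private instance
      N≢0 : NonZero N
      N≢0 = ℕ.>-nonZero (ℕP.<-trans (s≤s z≤n) 1<N)

    χ-+-multiple : ∀ r q → χ (r ℕ.+ q ℕ.* N) ≈ χ r
    χ-+-multiple r zero    = reflexive (≡.cong χ (ℕP.+-identityʳ r))
    χ-+-multiple r (suc q) = trans (reflexive (≡.cong χ regroup)) (trans (periodic _) (χ-+-multiple r q))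
      where
      regroup : r ℕ.+ suc q ℕ.* N ≡ r ℕ.+ q ℕ.* N ℕ.+ N
      regroup = ≡.trans (≡.cong (r ℕ.+_) (ℕP.+-comm N (q ℕ.* N))) (≡.sym (ℕP.+-assoc r (q ℕ.* N) N))

    χ≈χ% : ∀ n → χ n ≈ χ (n % N)
    χ≈χ% n = trans (reflexive (≡.cong χ (m≡m%n+[m/n]*n n N))) (χ-+-multiple (n % N) (n / N))

    sumFrom0≈sum1≤ : sumFrom 0 N χ ≈ sum1≤ N < χ
    sumFrom0≈sum1≤ = begin
      sumFrom 0 N χ          ≈⟨ sumFrom0≈f0+sum1≤ N χ ⟩
      χ 0 + sum1≤ N < χ      ≈⟨ +-congʳ (zero-iff-nonCoprime₂ 0 0⊥̸N) ⟩
      0# + sum1≤ N < χ       ≈⟨ +-identityˡ _ ⟩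
      sum1≤ N < χ            ∎
      where
      0⊥̸N : ¬ Coprime 0 N
      0⊥̸N 0⊥N = ℕP.<-irrefl (≡.sym (Coprimality.0-coprimeTo-m⇒m≡1 0⊥N)) 1<N

    χ*sum≈sum : ∀ {b} → Coprime b N → χ b * sum1≤ N < χ ≈ sum1≤ N < χ
    χ*sum≈sum {b} b⊥N = begin
      χ b * sum1≤ N < χ                        ≈⟨ *-congˡ sumFrom0≈sum1≤ ⟨
      χ b * sumFrom 0 N χ                      ≈⟨ *-distribˡ-sumFrom (χ b) χ 0 N ⟩
      sumFrom 0 N (λ a → χ b * χ a)            ≈⟨ sumFrom-cong 0 N (λ a → trans (sym (mult b a)) (χ≈χ% (b ℕ.* a))) ⟩
      sumFrom 0 N (λ a → χ ((b ℕ.* a) % N))    ≈⟨ sumFrom-*-% b⊥N χ ⟩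
      sumFrom 0 N χ                            ≈⟨ sumFrom0≈sum1≤ ⟩
      sum1≤ N < χ                              ∎

    -- Without decidable equality in K no b with χ b ≉ 1 can be picked, so S := Σ χ is compared
    -- with E := φ(N)·1 ≉ 0 instead: summing χ b S ≈ [b ⊥ N] S over b gives S S ≈ E S, and
    -- S ≈ E would force χ b ≈ 1 for every b prime to N.
    sum-χ≈0 : CharZero → ¬ InducedFrom N 1 χ → sum1≤ N < χ ≈ 0#
    sum-χ≈0 char0 χ≢χ₀ = x*x≈y*x⇒x≉y⇒x≈0 S*S≈E*S S≉E
      where
      S = sum1≤ N < χ
      E = sum1≤ N < principal N
      χ*S≈χ₀*S : ∀ b → χ b * S ≈ principal N b * S
      χ*S≈χ₀*S b with coprime? b N
      ... | yes b⊥N = trans (χ*sum≈sum b⊥N) (sym (*-identityˡ S))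
      ... | no b⊥̸N  = *-congʳ (zero-iff-nonCoprime₂ b b⊥̸N)
      S*S≈E*S : S * S ≈ E * S
      S*S≈E*S = begin
        S * S                                 ≈⟨ *-distribʳ-sumFrom S χ 1 (N ∸ 1) ⟩
        sum1≤ N < (λ b → χ b * S)             ≈⟨ sumFrom-cong 1 (N ∸ 1) χ*S≈χ₀*S ⟩
        sum1≤ N < (λ b → principal N b * S)   ≈⟨ *-distribʳ-sumFrom S (principal N) 1 (N ∸ 1) ⟨
        E * S                                 ∎
      S≉E : ¬ S ≈ E
      S≉E S≈E = χ≢χ₀ (λ a b a⊥N b⊥N _ → trans (χ≈1 a⊥N) (sym (χ≈1 b⊥N)))
        where
        χ≈1 : ∀ {b} → Coprime b N → χ b ≈ 1#
        χ≈1 {b} b⊥N = x*y≈y⇒y≉0⇒x≈1 (trans (*-congˡ (sym S≈E)) (trans (χ*sum≈sum b⊥N) S≈E))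
                                (sum-principal≉0 char0 1<N)

  -- Sums over primitive roots of unity

  module _ {h : ℕ} .{{_ : NonZero h}} {ω : Carrier} (ω-primitive : IsPrimitiveRoot h ω) where

    private
      ω^h≈1 : ω ^ h ≈ 1#
      ω^h≈1 = proj₁ ω-primitive

    ω^n≈1⇒h∣n : ∀ {n} → ω ^ n ≈ 1# → h ℕD.∣ n
    ω^n≈1⇒h∣n {n} ω^n≈1 with n % h in n%h≡
    ... | zero  = ℕD.m%n≡0⇒n∣m n h n%h≡
    ... | suc r = contradiction ω^[1+r]≈1 (proj₂ ω-primitive (suc r) (s≤s z≤n) (≡.subst (_< h) n%h≡ (m%n<n n h)))
      where
      ω^[1+r]≈1 : ω ^ suc r ≈ 1#
      ω^[1+r]≈1 = trans (^-congʳ ω (≡.sym n%h≡)) (trans (sym (^≈^% ω^h≈1 n)) ω^n≈1)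

    ω^[N*i]≉1 : ∀ {N i} → Coprime N h → 0 < i → i < h → ¬ ω ^ (N ℕ.* i) ≈ 1#
    ω^[N*i]≉1 {N} {suc i} N⊥h _ i<h ω^Ni≈1 =
      ℕP.<⇒≱ i<h (ℕD.∣⇒≤ (Coprimality.coprime-divisor (Coprimality.sym N⊥h) (ω^n≈1⇒h∣n ω^Ni≈1)))

    module _ {N : ℕ} (N⊥h : Coprime N h) where

      ζᴺ : ℕ → Carrier
      ζᴺ k = (ω ^ k) ^ N

      [ζᴺ-1]⁻¹ : ℕ → Carrier
      [ζᴺ-1]⁻¹ k = (ζᴺ k - 1#) ⁻¹

      ζᴺ-root : ∀ k → ζᴺ k ^ h ≈ 1#
      ζᴺ-root k = ^-root (^-root ω^h≈1 k) N

      [ζᴺ-1]*[ζᴺ-1]⁻¹≈1 : ∀ {k} → 0 < k → k < h → (ζᴺ k - 1#) * [ζᴺ-1]⁻¹ k ≈ 1#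
      [ζᴺ-1]*[ζᴺ-1]⁻¹≈1 {k} 0<k k<h = ⁻¹-inverseʳ (ζᴺ k - 1#) λ ζᴺ-1≈0 →
        ω^[N*i]≉1 N⊥h 0<k k<h (trans (sym (trans (^-comm ω k N) (^-assocʳ ω N k))) (x-y≈0⇒x≈y _ 1# ζᴺ-1≈0))

      sum-ζᴺ^i≈-1 : ∀ {i} → 0 < i → i < h → sum1≤ h < (λ k → ζᴺ k ^ i) ≈ - 1#
      sum-ζᴺ^i≈-1 {i} 0<i i<h = begin
        sum1≤ h < (λ k → ζᴺ k ^ i)
          ≈⟨ sumFrom-cong 1 (h ∸ 1) (λ k → trans (^-assocʳ (ω ^ k) N i) (^-comm ω k (N ℕ.* i))) ⟩
        sum1≤ h < (λ k → (ω ^ (N ℕ.* i)) ^ k)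
          ≈⟨ sum1≤-root≈-1 h (^-root ω^h≈1 (N ℕ.* i)) (ω^[N*i]≉1 N⊥h 0<i i<h) ⟩
        - 1#
          ∎

      sum-ζᴺ^[h∸r]*[ζᴺ-1]⁻¹ : ∀ {r} → r < h →
        sum1≤ h < (λ k → ζᴺ k ^ (h ∸ r) * [ζᴺ-1]⁻¹ k) ≈ sum1≤ h < [ζᴺ-1]⁻¹ + r × 1#
      sum-ζᴺ^[h∸r]*[ζᴺ-1]⁻¹ {r} r<h = begin
        sum1≤ h < (λ k → ζᴺ k ^ s * [ζᴺ-1]⁻¹ k)
          ≈⟨ sum1≤-congᵢ h (λ k 0<k k<h → geometric-tail ([ζᴺ-1]*[ζᴺ-1]⁻¹≈1 0<k k<h) (ζᴺ-root k) (ℕP.m∸n≤m h r)) ⟩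
        sum1≤ h < (λ k → [ζᴺ-1]⁻¹ k - tail k)
          ≈⟨ sumFrom-distrib-+ [ζᴺ-1]⁻¹ (λ k → - tail k) 1 (h ∸ 1) ⟩
        C + sum1≤ h < (λ k → - tail k)
          ≈⟨ +-congˡ (-‿distrib-sumFrom tail 1 (h ∸ 1)) ⟨
        C - sum1≤ h < tail
          ≈⟨ +-congˡ (-‿cong (sumFrom-comm (λ k i → ζᴺ k ^ i) 1 (h ∸ 1) s (h ∸ s))) ⟩
        C - sumFrom s (h ∸ s) (λ i → sum1≤ h < (λ k → ζᴺ k ^ i))
          ≈⟨ +-congˡ (-‿cong (sumFrom-congᵢ s (h ∸ s) λ i s≤i i<s+[h∸s] →
               sum-ζᴺ^i≈-1 (ℕP.<-≤-trans 0<s s≤i) (≡.subst (i <_) (ℕP.m+[n∸m]≡n (ℕP.m∸n≤m h r)) i<s+[h∸s]))) ⟩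
        C - sumFrom s (h ∸ s) (λ _ → - 1#)
          ≈⟨ +-congˡ (-‿cong (-‿distrib-sumFrom (λ _ → 1#) s (h ∸ s))) ⟨
        C - - sumFrom s (h ∸ s) (λ _ → 1#)
          ≈⟨ +-congˡ (trans (⁻¹-involutive _) (sumFrom-const 1# s (h ∸ s))) ⟩
        C + (h ∸ s) × 1#
          ≡⟨ ≡.cong (λ n → C + n × 1#) (ℕP.m∸[m∸n]≡n (ℕP.<⇒≤ r<h)) ⟩
        C + r × 1#
          ∎
        where
        s = h ∸ r
        0<s : 0 < s
        0<s = ℕP.m<n⇒0<n∸m r<h
        C = sum1≤ h < [ζᴺ-1]⁻¹
        tail : ℕ → Carrier
        tail k = sumFrom s (h ∸ s) (ζᴺ k ^_)

      Lχ-twisted-sum : CharZero → 1 < N → ∀ {χ} → HasConductor N χ → ∀ m →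
        sum1≤ h < (λ k → Lχ N χ (ω ^ k) * (ω ^ k) ^ℤ (ℤ.- m))
          ≈ sum1≤ N < (λ a → flatDiv h N (m ℤ.- + a) × χ a)
      Lχ-twisted-sum char0 1<N {χ} χ-conductor m = begin
        sum1≤ h < (λ k → Lχ N χ (ω ^ k) * (ω ^ k) ^ℤ (ℤ.- m))
          ≈⟨ sumFrom-cong 1 (h ∸ 1) (λ k → Lχ-twisted≈sum (^-root ω^h≈1 k) N⊥h χ m) ⟩
        sum1≤ h < (λ k → sum1≤ N < (λ a → χ a * (ζᴺ k ^ (h ∸ r a) * [ζᴺ-1]⁻¹ k)))
          ≈⟨ sumFrom-comm _ 1 (h ∸ 1) 1 (N ∸ 1) ⟩
        sum1≤ N < (λ a → sum1≤ h < (λ k → χ a * (ζᴺ k ^ (h ∸ r a) * [ζᴺ-1]⁻¹ k)))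
          ≈⟨ sumFrom-cong 1 (N ∸ 1) (λ a → *-distribˡ-sumFrom (χ a) _ 1 (h ∸ 1)) ⟨
        sum1≤ N < (λ a → χ a * sum1≤ h < (λ k → ζᴺ k ^ (h ∸ r a) * [ζᴺ-1]⁻¹ k))
          ≈⟨ sumFrom-cong 1 (N ∸ 1) (λ a → *-congˡ (sum-ζᴺ^[h∸r]*[ζᴺ-1]⁻¹ (r<h a))) ⟩
        sum1≤ N < (λ a → χ a * (C + r a × 1#))
          ≈⟨ sumFrom-cong 1 (N ∸ 1) (λ a → trans (distribˡ (χ a) C _) (+-congˡ (χ*n≈n×χ a))) ⟩
        sum1≤ N < (λ a → χ a * C + r a × χ a)
          ≈⟨ sumFrom-distrib-+ (λ a → χ a * C) (λ a → r a × χ a) 1 (N ∸ 1) ⟩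
        sum1≤ N < (λ a → χ a * C) + sum1≤ N < (λ a → r a × χ a)
          ≈⟨ +-congʳ (*-distribʳ-sumFrom C χ 1 (N ∸ 1)) ⟨
        sum1≤ N < χ * C + sum1≤ N < (λ a → r a × χ a)
          ≈⟨ +-congʳ (trans (*-congʳ (sum-χ≈0 1<N isChar char0 (isPrimitive 1 (ℕD.1∣ N) 1<N))) (zeroˡ C)) ⟩
        0# + sum1≤ N < (λ a → r a × χ a)
          ≈⟨ +-identityˡ _ ⟩
        sum1≤ N < (λ a → r a × χ a)
          ∎
        where
        open HasConductor χ-conductor
        r : ℕ → ℕ
        r a = flatDiv h N (m ℤ.- + a)
        r<h : ∀ a → r a < h
        r<h a = proj₁ (flatDiv-spec N⊥h (m ℤ.- + a))
        C = sum1≤ h < [ζᴺ-1]⁻¹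
        χ*n≈n×χ : ∀ a → χ a * (r a × 1#) ≈ r a × χ a
        χ*n≈n×χ a = trans (×-comm-* (r a) (χ a) 1#) (×-congʳ (r a) (*-identityʳ (χ a)))

lemma3p1 : {c ℓ : Level} (K : Field c ℓ) →
    let open Field K in let open FieldDefs K in
    CharZero →
    (p N : ℕ) → Prime p → 1 < N → Coprime N p →
    (χ : ℕ → Carrier) → HasConductor N χ →
    (n : ℕ) (m : ℤ) (ω : Carrier) → IsPrimitiveRoot (p ℕ.^ n) ω →
    sum1≤ (p ℕ.^ n) < (λ k → Lχ N χ (ω ^ k) * ((ω ^ k) ^ℤ (ℤ.- m)))
      ≈ sum1≤ N < (λ a → flatDiv (p ℕ.^ n) N (m ℤ.- (+ a)) × χ a)
lemma3p1 K char0 p N p-prime 1<N N⊥p χ χ-conductor n m ω ω-primitive =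
  Lχ-twisted-sum K ω-primitive (coprime-^ N⊥p n) char0 1<N χ-conductor m
  where
  instance
    p≢0 : NonZero p
    p≢0 = prime⇒nonZero p-prime
    pⁿ≢0 : NonZero (p ℕ.^ n)
    pⁿ≢0 = ℕP.m^n≢0 p n
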